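{- For $n\in\mathbb{N}$ let $E_n=3^n+2$. Then for every $n\ge 1$, $E_n$ is not a triangular number, i.e. $E_n\neq k(k+1)/2$ for every $k\in\mathbb{N}$. -}

module Defs where

open import Data.Nat using (ℕ; suc; _+_; _*_; _^_; _/_)

E : ℕ → ℕ
E n = 3 ^ n + 2

-- the k-th triangular number k(k+1)/2 (division is exact since k(k+1) is even)
triangular : ℕ → ℕ
triangular k = (k * suc k) / 2

-- Modulo 3 the triangular numbers only take the residues 0 and 1: the
-- sequence T_k mod 3 is periodic with period 3, starting 0, 1, 0, because
-- T_{k+3} = T_k + 3(k + 2).  For n ≥ 1, however, 3^n + 2 ≡ 2 (mod 3).
module Submission where

open import Defs
open import Data.Nat using (ℕ; _≥_; suc; _+_; _*_; _^_; _/_; _%_)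
open import Data.Nat.DivMod using ([m+kn]%n≡m%n; m*n/n≡m; +-distrib-/-∣ʳ)
open import Data.Nat.Divisibility using (divides-refl)
open import Data.Nat.Properties using (+-comm; *-comm)
open import Data.Nat.Solver using (module +-*-Solver)
open import Relation.Binary.PropositionalEquality
open import Function using (_∘_)
open ≡-Reasoning
open +-*-Solver using (solve; _:+_; _:*_; con; _:=_)

triangular-suc : ∀ k → triangular (suc k) ≡ triangular k + suc k
triangular-suc k = begin
  (suc k * suc (suc k)) / 2          ≡⟨ cong (_/ 2) (expand k) ⟩
  (k * suc k + suc k * 2) / 2        ≡⟨ +-distrib-/-∣ʳ (k * suc k) (divides-refl (suc k)) ⟩
  k * suc k / 2 + suc k * 2 / 2      ≡⟨ cong (triangular k +_) (m*n/n≡m (suc k) 2) ⟩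
  triangular k + suc k               ∎
  where
  expand : ∀ k → suc k * suc (suc k) ≡ k * suc k + suc k * 2
  expand = solve 1 (λ k → (con 1 :+ k) :* (con 2 :+ k) := k :* (con 1 :+ k) :+ (con 1 :+ k) :* con 2) refl

triangular-+3 : ∀ k → triangular (3 + k) ≡ triangular k + (2 + k) * 3
triangular-+3 k = begin
  triangular (3 + k)                                   ≡⟨ triangular-suc (2 + k) ⟩
  triangular (2 + k) + (3 + k)                         ≡⟨ cong (_+ (3 + k)) (triangular-suc (1 + k)) ⟩
  triangular (1 + k) + (2 + k) + (3 + k)               ≡⟨ cong (λ t → t + (2 + k) + (3 + k)) (triangular-suc k) ⟩
  triangular k + (1 + k) + (2 + k) + (3 + k)           ≡⟨ regroup (triangular k) k ⟩
  triangular k + (2 + k) * 3                           ∎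
  where
  regroup : ∀ t k → t + (1 + k) + (2 + k) + (3 + k) ≡ t + (2 + k) * 3
  regroup = solve 2 (λ t k → t :+ (con 1 :+ k) :+ (con 2 :+ k) :+ (con 3 :+ k)
                             := t :+ (con 2 :+ k) :* con 3) refl

triangular-%3-periodic : ∀ k → triangular (3 + k) % 3 ≡ triangular k % 3
triangular-%3-periodic k = begin
  triangular (3 + k) % 3                ≡⟨ cong (_% 3) (triangular-+3 k) ⟩
  (triangular k + (2 + k) * 3) % 3      ≡⟨ [m+kn]%n≡m%n (triangular k) (2 + k) 3 ⟩
  triangular k % 3                      ∎

triangular%3≢2 : ∀ k → triangular k % 3 ≢ 2
triangular%3≢2 0 ()
triangular%3≢2 1 ()
triangular%3≢2 2 ()
triangular%3≢2 (suc (suc (suc k))) = triangular%3≢2 k ∘ trans (sym (triangular-%3-periodic k))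

E-suc%3 : ∀ n → E (suc n) % 3 ≡ 2
E-suc%3 n = begin
  (3 * 3 ^ n + 2) % 3   ≡⟨ cong (_% 3) (trans (+-comm (3 * 3 ^ n) 2) (cong (2 +_) (*-comm 3 (3 ^ n)))) ⟩
  (2 + 3 ^ n * 3) % 3   ≡⟨ [m+kn]%n≡m%n 2 (3 ^ n) 3 ⟩
  2                     ∎

mainTheorem8 : (n : ℕ) → n ≥ 1 → (k : ℕ) → E n ≢ triangular k
mainTheorem8 (suc n) _ k E≡T = triangular%3≢2 k (begin
  triangular k % 3   ≡⟨ cong (_% 3) (sym E≡T) ⟩
  E (suc n) % 3      ≡⟨ E-suc%3 n ⟩
  2                  ∎)
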